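{- Let $M$ be a finite LTS and $B\subseteq\mathit{Act}$. Every finite path of $M$ can be extended to a path of $M$ that satisfies weak $B$-hyperfairness of actions (i.e., weak $B$-hyperfairness of actions is feasible).
   Context: LTS $M=(S,s_{init},\mathit{Act},\mathit{Trans})$ with $S$ and $\mathit{Act}$ finite. Paths: alternating sequences $s_0t_1s_1\dots$ starting in a state, infinite or ending in a state, consecutive; a path $\pi'$ extends a finite path $\pi$ if $\pi$ is a prefix of $\pi'$. An action occurs on a path if a transition on it carries that label; $\alpha$-free = no action of $\alpha$ occurs. An action is enabled in $s$ if a transition with that label leaves $s$. $\overline{B}=\mathit{Act}\setminus B$. A state $s$ is $B$-reachable from $s'$ if some $B$-free path from $s'$ ends in $s$; an action $a$ is $B$-reachable from $s$ if it is enabled in some state $B$-reachable from $s$; $a$ is perpetually $B$-reachable on a path if $B$-reachable from every state of it. A path $\pi$ satisfies weak $B$-hyperfairness of actions iff for every suffix $\pi'$ of $\pi$, every $a\in\overline{B}$ perpetually $B$-reachable in $\pi'$ occurs in $\pi'$. -}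

module Defs where

open import Data.Nat using (ℕ; zero; suc; _≤_; _<_)
open import Data.Fin using (Fin)
open import Data.Fin.Subset using (Subset; _∈_; _∉_)
open import Data.Bool using (Bool; T)
open import Data.Maybe using (Maybe; just; nothing)
open import Data.Unit using (⊤)
open import Data.Product using (Σ; ∃; _×_; _,_)
open import Relation.Binary.PropositionalEquality using (_≡_)

record LTS : Set where
  field
    nS    : ℕ
    nA    : ℕ
    init  : Fin nS
    trans : Fin nS → Fin nA → Fin nS → Bool

  S : Set
  S = Fin nS

  Act : Set
  Act = Fin nA

-- Length of a path (number of transitions): just n = finite, nothing = infinite.
Len : Set
Len = Maybe ℕ

StepIdx : Len → ℕ → Set
StepIdx (just n) i = i < n
StepIdx nothing  i = ⊤

StateIdx : Len → ℕ → Set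
StateIdx (just n) i = i ≤ n
StateIdx nothing  i = ⊤

module _ (M : LTS) where
  open LTS M

  -- A path s₀ t₁ s₁ …: state i is s_i, transition t_{i+1} = (state i, act i, state (suc i)).
  -- Values of state/act at indices beyond the length are irrelevant.
  record Path : Set where
    field
      len   : Len
      state : ℕ → S
      act   : ℕ → Act
      valid : ∀ i → StepIdx len i → T (trans (state i) (act i) (state (suc i)))
  open Path public

  Finite : Path → Set
  Finite π = ∃ λ n → len π ≡ just n

  Extends : Path → Path → Set
  Extends π' π =
    (∀ i → StateIdx (len π) i → StateIdx (len π') i × state π' i ≡ state π i) ×
    (∀ i → StepIdx (len π) i → act π' i ≡ act π i)

  Enabled : Act → S → Set
  Enabled a s = ∃ λ s' → T (trans s a s')

  StateBReachable : Subset nA → S → S → Set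
  StateBReachable B s s' = Σ Path λ π → Σ ℕ λ n →
    len π ≡ just n × state π 0 ≡ s' × state π n ≡ s ×
    (∀ i → i < n → act π i ∉ B)

  ActBReachable : Subset nA → Act → S → Set
  ActBReachable B a s = ∃ λ s'' → StateBReachable B s'' s × Enabled a s''

  WeakHyperfair : Subset nA → Path → Set
  WeakHyperfair B π = ∀ k → StateIdx (len π) k → ∀ (a : Act) → a ∉ B →
    (∀ j → k ≤ j → StateIdx (len π) j → ActBReachable B a (state π j)) →
    ∃ λ i → k ≤ i × StepIdx (len π) i × act π i ≡ a

{-# OPTIONS --safe #-}
-- Let e be the last state of the given path. If some state t reachable from e is stuck, i.e.
-- no action outside B is B-reachable from t, then ending the path at t is weakly
-- B-hyperfair, because every suffix contains t. Otherwise the path is continued forever in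
-- rounds: round m walks B-free to a state enabling the m-th action of a round-robin schedule
-- and takes it, if that action is B-reachable when the round starts, and otherwise takes some
-- other B-reachable action. An action perpetually B-reachable on a suffix is scheduled by
-- infinitely many rounds starting inside it, so it occurs there. All these case distinctions
-- are decidable since reachability in a finite graph is: the sets of states reachable within
-- k steps grow strictly until they are closed under successors, hence after |S| steps.
module Submission where

open import Data.Bool using (T; true)
open import Data.Empty using (⊥-elim)
open import Data.Fin using (Fin; toℕ)
open import Data.Fin.Properties using (any?; all?; nonZeroIndex; toℕ-injective; toℕ-fromℕ<; toℕ<n)
open import Data.Fin.Subset using (Subset; _∈_; _∉_; _⊆_; ⁅_⁆; ∣_∣)
open import Data.Fin.Subset.Properties using (_∈?_; x∈⁅x⁆; x∈⁅y⁆⇒x≡y; ∣⁅x⁆∣≡1; p⊂q⇒∣p∣<∣q∣; ∣p∣≤n)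
open import Data.Maybe using (just; nothing)
open import Data.Nat using (ℕ; zero; suc; _+_; _*_; _∸_; _≤_; _<_; z≤n; s≤s; z<s; s<s; NonZero)
open import Data.Nat.DivMod using (_mod_; _%_; [m+kn]%n≡m%n; m<n⇒m%n≡m)
open import Data.Nat.Properties
  using ( ≤-refl; ≤-trans; <-≤-trans; <-irrefl; <⇒≤; m≤n⇒m≤o+n; m≤n⇒m≤n+o; m≤m*n; m≤n+m∸n
        ; m≤n+o⇒m∸n≤o; +-monoʳ-≤; +-monoʳ-<; +-cancelˡ-<; +-suc)
open import Data.Unit using (tt)
open import Data.Product using (Σ; ∃; _×_; _,_; proj₁; proj₂)
open import Data.Sum using (_⊎_; inj₁; inj₂)
open import Data.Vec using (tabulate)
open import Data.Vec.Properties using (lookup∘tabulate; []=⇒lookup; lookup⇒[]=)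
open import Function using (_∘_)
open import Level using (Level; 0ℓ)
open import Relation.Binary using (Rel; _⇒_) renaming (Decidable to Decidable₂)
open import Relation.Binary.Construct.Closure.ReflexiveTransitive using (Star; ε; _◅_; _◅◅_; map)
open import Relation.Binary.PropositionalEquality
  using (_≡_; refl; sym; cong; subst; subst₂; module ≡-Reasoning) renaming (trans to ≡-trans)
open import Relation.Nullary using (Dec; yes; no; does; ¬_; ¬?)
open import Relation.Nullary.Decidable
  using (dec-true; isYes≗does; toWitness; map′; T?; _→-dec_; _⊎-dec_; _×-dec_)
open import Relation.Unary using (Pred; Decidable; U)
open import Relation.Unary.Properties using (U?)

open import Defs

private
  variable
    a ℓ : Level
    A : Set a
    n : ℕ

chain⇒star : {R : Rel A ℓ} (f : ℕ → A) (n : ℕ) →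
  (∀ i → i < n → R (f i) (f (suc i))) → Star R (f 0) (f n)
chain⇒star f zero    _    = ε
chain⇒star f (suc n) step = step 0 z<s ◅ chain⇒star (f ∘ suc) n (λ i i<n → step (suc i) (s<s i<n))

module _ {P : Pred (Fin n) ℓ} (P? : Decidable P) where

  fromDec : Subset n
  fromDec = tabulate (does ∘ P?)

  ∈-fromDec⁺ : ∀ {v} → P v → v ∈ fromDec
  ∈-fromDec⁺ {v} pv = lookup⇒[]= v fromDec (≡-trans (lookup∘tabulate _ v) (dec-true (P? v) pv))

  ∈-fromDec⁻ : ∀ {v} → v ∈ fromDec → P v
  ∈-fromDec⁻ {v} v∈ = toWitness (subst T (sym (≡-trans (isYes≗does (P? v)) does≡true)) _)
    where
    does≡true : does (P? v) ≡ true
    does≡true = ≡-trans (sym (lookup∘tabulate _ v)) ([]=⇒lookup v∈)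

module FiniteReachability {E : Rel (Fin n) ℓ} (E? : Decidable₂ E) where

  Expanded : Subset n → Pred (Fin n) ℓ
  Expanded X v = v ∈ X ⊎ ∃ λ u → u ∈ X × E u v

  Expanded? : ∀ X → Decidable (Expanded X)
  Expanded? X v = (v ∈? X) ⊎-dec any? (λ u → (u ∈? X) ×-dec E? u v)

  expand : Subset n → Subset n
  expand X = fromDec (Expanded? X)

  ⊆-expand : ∀ {X} → X ⊆ expand X
  ⊆-expand {X} v∈X = ∈-fromDec⁺ (Expanded? X) (inj₁ v∈X)

  Closed : Subset n → Set ℓ
  Closed X = ∀ {u v} → u ∈ X → E u v → v ∈ X

  expand-⊆ : ∀ {X} → Closed X → expand X ⊆ X
  expand-⊆ {X} closed v∈ with ∈-fromDec⁻ (Expanded? X) v∈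
  ... | inj₁ v∈X             = v∈X
  ... | inj₂ (u , u∈X , u→v) = closed u∈X u→v

  expand-closed : ∀ {X} → Closed X → Closed (expand X)
  expand-closed closed u∈ u→v = ⊆-expand (closed (expand-⊆ closed u∈) u→v)

  closed-or-grows : ∀ X → Closed X ⊎ ∣ X ∣ < ∣ expand X ∣
  closed-or-grows X with any? (λ v → (v ∈? expand X) ×-dec ¬? (v ∈? X))
  ... | yes new = inj₂ (p⊂q⇒∣p∣<∣q∣ (⊆-expand , new))
  ... | no ¬new = inj₁ closed
    where
    closed : Closed X
    closed {u} {v} u∈X u→v with v ∈? X
    ... | yes v∈X = v∈X
    ... | no  v∉X = ⊥-elim (¬new (v , ∈-fromDec⁺ (Expanded? X) (inj₂ (u , u∈X , u→v)) , v∉X))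

  module _ (s : Fin n) where

    reachableWithin : ℕ → Subset n
    reachableWithin zero    = ⁅ s ⁆
    reachableWithin (suc k) = expand (reachableWithin k)

    reachableWithin-sound : ∀ k {v} → v ∈ reachableWithin k → Star E s v
    reachableWithin-sound zero    v∈ rewrite x∈⁅y⁆⇒x≡y s v∈ = ε
    reachableWithin-sound (suc k) v∈ with ∈-fromDec⁻ (Expanded? (reachableWithin k)) v∈
    ... | inj₁ v∈′            = reachableWithin-sound k v∈′
    ... | inj₂ (u , u∈ , u→v) = reachableWithin-sound k u∈ ◅◅ (u→v ◅ ε)

    ∈-reachableWithin : ∀ k → s ∈ reachableWithin k
    ∈-reachableWithin zero    = x∈⁅x⁆ s
    ∈-reachableWithin (suc k) = ⊆-expand (∈-reachableWithin k)

    reachableWithin-grows-or-closed : ∀ k → k < ∣ reachableWithin k ∣ ⊎ Closed (reachableWithin k)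
    reachableWithin-grows-or-closed zero    = inj₁ (subst (0 <_) (sym (∣⁅x⁆∣≡1 s)) z<s)
    reachableWithin-grows-or-closed (suc k) with reachableWithin-grows-or-closed k
    ... | inj₂ closed = inj₂ (expand-closed closed)
    ... | inj₁ k<∣X∣ with closed-or-grows (reachableWithin k)
    ...   | inj₁ closed = inj₂ (expand-closed closed)
    ...   | inj₂ grows  = inj₁ (<-≤-trans (s<s k<∣X∣) grows)

    reachableWithin-closed : Closed (reachableWithin n)
    reachableWithin-closed with reachableWithin-grows-or-closed n
    ... | inj₁ n<∣X∣ = ⊥-elim (<-irrefl refl (<-≤-trans n<∣X∣ (∣p∣≤n (reachableWithin n))))
    ... | inj₂ closed = closed

  closed-star : ∀ {X u v} → Closed X → u ∈ X → Star E u v → v ∈ X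
  closed-star closed u∈X ε           = u∈X
  closed-star closed u∈X (u→w ◅ w→v) = closed-star closed (closed u∈X u→w) w→v

  star? : Decidable₂ (Star E)
  star? s t = map′ (reachableWithin-sound s n)
                   (closed-star (reachableWithin-closed s) (∈-reachableWithin s n))
                   (t ∈? reachableWithin s n)

mod-surjective-≥ : ∀ m .{{_ : NonZero m}} (i : Fin m) k → ∃ λ j → k ≤ j × j mod m ≡ i
mod-surjective-≥ m i k = toℕ i + k * m , m≤n⇒m≤o+n (toℕ i) (m≤m*n k m) , toℕ-injective (begin
  toℕ ((toℕ i + k * m) mod m) ≡⟨ toℕ-fromℕ< _ ⟩
  (toℕ i + k * m) % m         ≡⟨ [m+kn]%n≡m%n (toℕ i) k m ⟩
  toℕ i % m                   ≡⟨ m<n⇒m%n≡m (toℕ<n i) ⟩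
  toℕ i                       ∎)
  where open ≡-Reasoning

m∸n≤o⇒m≤n+o : ∀ {m n o} → m ∸ n ≤ o → m ≤ n + o
m∸n≤o⇒m≤n+o {m} {n} m∸n≤o = ≤-trans (m≤n+m∸n m n) (+-monoʳ-≤ n m∸n≤o)

length : {R : Rel A ℓ} {x y : A} → Star R x y → ℕ
length ε       = 0
length (_ ◅ w) = suc (length w)

splice : ℕ → (ℕ → A) → (ℕ → A) → ℕ → A
splice zero    f g i       = g i
splice (suc n) f g zero    = f zero
splice (suc n) f g (suc i) = splice n (f ∘ suc) g i

splice-< : ∀ n {f g : ℕ → A} {i} → i < n → splice n f g i ≡ f i
splice-< (suc n) {i = zero}  _          = refl
splice-< (suc n) {i = suc i} (s<s i<n) = splice-< n i<n

splice-≤ : ∀ n {f g : ℕ → A} {i} → f n ≡ g 0 → i ≤ n → splice n f g i ≡ f i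
splice-≤ zero    {i = zero}  fn≡g0 z≤n       = sym fn≡g0
splice-≤ (suc n) {i = zero}  _     _         = refl
splice-≤ (suc n) {i = suc i} fn≡g0 (s≤s i≤n) = splice-≤ n fn≡g0 i≤n

splice-+ : ∀ n {f g : ℕ → A} d → splice n f g (n + d) ≡ g d
splice-+ zero    d = refl
splice-+ (suc n) d = splice-+ n d

data SplitAt (n : ℕ) : ℕ → Set where
  before : ∀ {i} → i < n → SplitAt n i
  after  : ∀ d → SplitAt n (n + d)

splitAt : ∀ n i → SplitAt n i
splitAt zero    i       = after i
splitAt (suc n) zero    = before z<s
splitAt (suc n) (suc i) with splitAt n i
... | before i<n = before (s<s i<n)
... | after d    = after d

_+ᴸ_ : ℕ → Len → Len
n +ᴸ just m  = just (n + m)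
n +ᴸ nothing = nothing

StateIdx-≤ : ∀ {n i} l → i ≤ n → StateIdx (n +ᴸ l) i
StateIdx-≤ (just m) i≤n = m≤n⇒m≤n+o m i≤n
StateIdx-≤ nothing  _   = tt

StateIdx-+ : ∀ {n d} l → StateIdx l d → StateIdx (n +ᴸ l) (n + d)
StateIdx-+ {n} (just m) d≤m = +-monoʳ-≤ n d≤m
StateIdx-+     nothing  _   = tt

StateIdx-∸ : ∀ {n k} l → StateIdx (n +ᴸ l) k → StateIdx l (k ∸ n)
StateIdx-∸ {n} {k} (just m) k≤n+m = m≤n+o⇒m∸n≤o k n k≤n+m
StateIdx-∸         nothing  _     = tt

StepIdx-+ : ∀ {n d} l → StepIdx l d → StepIdx (n +ᴸ l) (n + d)
StepIdx-+ {n} (just m) d<m = +-monoʳ-< n d<m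
StepIdx-+     nothing  _   = tt

StepIdx-+⁻ : ∀ {n d} l → StepIdx (n +ᴸ l) (n + d) → StepIdx l d
StepIdx-+⁻ {n} {d} (just m) n+d<n+m = +-cancelˡ-< n d m n+d<n+m
StepIdx-+⁻         nothing  _       = tt

module _ (M : LTS) where
  open LTS M

  Step : Pred Act 0ℓ → Rel S 0ℓ
  Step P s s′ = ∃ λ a → P a × T (trans s a s′)

  label : ∀ {P s s′} → Step P s s′ → Act
  label = proj₁

  fires : ∀ {P s s′} (x : Step P s s′) → T (trans s (label x) s′)
  fires = proj₂ ∘ proj₂

  Step? : ∀ {P} → Decidable P → Decidable₂ (Step P)
  Step? P? s s′ = any? (λ a → P? a ×-dec T? (trans s a s′))

  forget : ∀ {P} → Step P ⇒ Step U
  forget (a , _ , t) = a , tt , t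

  trans-cong : ∀ {s s′ a a′ t t′} → s ≡ s′ → a ≡ a′ → t ≡ t′ → T (trans s′ a′ t′) → T (trans s a t)
  trans-cong refl refl refl tr = tr

  path⇒star : ∀ {P} (π : Path M) {n} → len π ≡ just n → (∀ i → i < n → P (act π i)) →
              Star (Step P) (state π 0) (state π n)
  path⇒star π {n} len≡ P-acts = chain⇒star (state π) n λ i i<n →
    act π i , P-acts i i<n , valid π i (subst (λ l → StepIdx l i) (sym len≡) i<n)

  module Append (π : Path M) {n} (len≡ : len π ≡ just n) (ρ : Path M) (glue : state π n ≡ state ρ 0) where

    splice-valid : ∀ i → StepIdx (n +ᴸ len ρ) i →
      T (trans (splice n (state π) (state ρ) i) (splice n (act π) (act ρ) i) (splice n (state π) (state ρ) (suc i)))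
    splice-valid i idx with splitAt n i
    ... | before i<n = trans-cong (splice-≤ n glue (<⇒≤ i<n)) (splice-< n i<n) (splice-≤ n glue i<n)
                                  (valid π i (subst (λ l → StepIdx l i) (sym len≡) i<n))
    ... | after d    = trans-cong (splice-+ n d) (splice-+ n d)
                                  (≡-trans (cong (splice n (state π) (state ρ)) (sym (+-suc n d))) (splice-+ n (suc d)))
                                  (valid ρ d (StepIdx-+⁻ (len ρ) idx))

    path : Path M
    path = record
      { len   = n +ᴸ len ρ
      ; state = splice n (state π) (state ρ)
      ; act   = splice n (act π) (act ρ)
      ; valid = splice-valid
      }

    extends : Extends M path π
    extends = (λ i idx → let i≤n = subst (λ l → StateIdx l i) len≡ idx in
                         StateIdx-≤ (len ρ) i≤n , splice-≤ n glue i≤n)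
            , (λ i idx → splice-< n (subst (λ l → StepIdx l i) len≡ idx))

    hyperfair : ∀ {B} → WeakHyperfair M B ρ → WeakHyperfair M B path
    hyperfair {B} fair k k-idx a a∉B perp =
      let i , k∸n≤i , idx , act≡a = fair (k ∸ n) (StateIdx-∸ (len ρ) k-idx) a a∉B perp-ρ
      in n + i , m∸n≤o⇒m≤n+o k∸n≤i , StepIdx-+ (len ρ) idx , ≡-trans (splice-+ n i) act≡a
      where
      perp-ρ : ∀ j → k ∸ n ≤ j → StateIdx (len ρ) j → ActBReachable M B a (state ρ j)
      perp-ρ j k∸n≤j idx = subst (ActBReachable M B a) (splice-+ n j)
                                 (perp (n + j) (m∸n≤o⇒m≤n+o k∸n≤j) (StateIdx-+ (len ρ) idx))

  -- Paths carry an action at every index, so even an empty walk needs an action to become one.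
  module _ (a₀ : Act) where

    walkState : ∀ {P s t} → Star (Step P) s t → ℕ → S
    walkState {s = s} _       zero    = s
    walkState {s = s} ε       (suc i) = s
    walkState         (_ ◅ w) (suc i) = walkState w i

    walkAct : ∀ {P s t} → Star (Step P) s t → ℕ → Act
    walkAct ε       _       = a₀
    walkAct (x ◅ _) zero    = label x
    walkAct (_ ◅ w) (suc i) = walkAct w i

    walkValid : ∀ {P s t} (w : Star (Step P) s t) i → i < length w →
                T (trans (walkState w i) (walkAct w i) (walkState w (suc i)))
    walkValid (x ◅ _) zero    _         = fires x
    walkValid (_ ◅ w) (suc i) (s<s i<n) = walkValid w i i<n

    walk⇒path : ∀ {P s t} → Star (Step P) s t → Path M
    walk⇒path w = record
      { len = just (length w) ; state = walkState w ; act = walkAct w ; valid = walkValid w }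

    walkState-end : ∀ {P s t} (w : Star (Step P) s t) → walkState w (length w) ≡ t
    walkState-end ε       = refl
    walkState-end (_ ◅ w) = walkState-end w

    walkAct-satisfies : ∀ {P s t} (w : Star (Step P) s t) i → i < length w → P (walkAct w i)
    walkAct-satisfies ((_ , p , _) ◅ _) zero    _         = p
    walkAct-satisfies (_ ◅ w)           (suc i) (s<s i<n) = walkAct-satisfies w i i<n

    module _ (B : Subset nA) where

      StateBReachable⇒star : ∀ {s s′} → StateBReachable M B s s′ → Star (Step (_∉ B)) s′ s
      StateBReachable⇒star (π , _ , len≡ , start≡ , end≡ , B-free) =
        subst₂ (Star (Step (_∉ B))) start≡ end≡ (path⇒star π len≡ B-free)

      star⇒StateBReachable : ∀ {s s′} → Star (Step (_∉ B)) s′ s → StateBReachable M B s s′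
      star⇒StateBReachable w = walk⇒path w , length w , refl , refl , walkState-end w , walkAct-satisfies w

      StateBReachable? : ∀ s s′ → Dec (StateBReachable M B s s′)
      StateBReachable? s s′ = map′ star⇒StateBReachable StateBReachable⇒star
        (FiniteReachability.star? (Step? (λ a → ¬? (a ∈? B))) s′ s)

      ActBReachable? : ∀ a s → Dec (ActBReachable M B a s)
      ActBReachable? a s = any? λ s″ → StateBReachable? s″ s ×-dec any? (λ s‴ → T? (trans s″ a s‴))

      Stuck : S → Set
      Stuck s = ∀ a → a ∉ B → ¬ ActBReachable M B a s

      Stuck? : ∀ s → Dec (Stuck s)
      Stuck? s = all? λ a → ¬? (a ∈? B) →-dec ¬? (ActBReachable? a s)

      stuck⇒hyperfair : ∀ (π : Path M) {n} → len π ≡ just n → Stuck (state π n) → WeakHyperfair M B π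
      stuck⇒hyperfair π {n} len≡ stuck k k-idx a a∉B perp = ⊥-elim (stuck a a∉B (perp n k≤n n-idx))
        where
        k≤n : k ≤ n
        k≤n = subst (λ l → StateIdx l k) len≡ k-idx
        n-idx : StateIdx (len π) n
        n-idx = subst (λ l → StateIdx l n) (sym len≡) ≤-refl

      module FairRun (e : S) (live : ∀ {t} → Star (Step U) e t → ∃ λ a → ActBReachable M B a t) where

        private instance
          nA-nonZero : NonZero nA
          nA-nonZero = nonZeroIndex a₀

        schedule : ℕ → Act
        schedule m = m mod nA

        target : ℕ → ∀ {t} → Star (Step U) e t → ∃ λ a → ActBReachable M B a t
        target m {t} r with ActBReachable? (schedule m) t
        ... | yes reachable = schedule m , reachable
        ... | no  _         = live r

        target-scheduled : ∀ m {t} (r : Star (Step U) e t) → ActBReachable M B (schedule m) t →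
                           proj₁ (target m r) ≡ schedule m
        target-scheduled m {t} r reachable with ActBReachable? (schedule m) t
        ... | yes _           = refl
        ... | no  unreachable = ⊥-elim (unreachable reachable)

        -- The run is generated from the rest of its current round: first approach, then
        -- final, whose label is the action the round aims at.
        record Config : Set where
          constructor config
          field
            round                 : ℕ
            {here launch landing} : S
            approach              : Star (Step U) here launch
            final                 : Step U launch landing
            reached               : Star (Step U) e landing
        open Config

        round-towards : ℕ → ∀ {t} → Star (Step U) e t → ∀ {a} → ActBReachable M B a t → Config
        round-towards m {t} r {a} (s″ , reachable , s‴ , enabled) =
          config m to-s″ step (r ◅◅ to-s″ ◅◅ (step ◅ ε))
          where
          to-s″ : Star (Step U) t s″
          to-s″ = map forget (StateBReachable⇒star reachable)
          step : Step U s″ s‴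
          step = a , tt , enabled

        start : ℕ → ∀ {t} → Star (Step U) e t → Config
        start m r = round-towards m r (proj₂ (target m r))

        current : (c : Config) → ∃ (Step U (here c))
        current (config _ ε       x _) = _ , x
        current (config _ (y ◅ _) _ _) = _ , y

        advance : Config → Config
        advance (config m ε       _ r) = start (suc m) r
        advance (config m (_ ◅ w) x r) = config m w x r

        advance-here : ∀ c → here (advance c) ≡ proj₁ (current c)
        advance-here (config _ ε       _ _) = refl
        advance-here (config _ (_ ◅ _) _ _) = refl

        run : ℕ → Config
        run zero    = start 0 ε
        run (suc i) = advance (run i)

        fairPath : Path M
        fairPath = record
          { len   = nothing
          ; state = here ∘ run
          ; act   = label ∘ proj₂ ∘ current ∘ run
          ; valid = λ i _ → subst (T ∘ trans (here (run i)) _) (sym (advance-here (run i)))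
                                  (fires (proj₂ (current (run i))))
          }

        Starts : ℕ → Config → Set
        Starts m c = ∃ λ t → ∃ λ (r : Star (Step U) e t) → c ≡ start m r

        finishes : ∀ i {m s s′ s″} (w : Star (Step U) s s′) (x : Step U s′ s″) (r : Star (Step U) e s″) →
                   run i ≡ config m w x r →
                   ∃ λ j → i ≤ j × act fairPath j ≡ label x × Starts (suc m) (run (suc j))
        finishes i ε       x r run≡ =
          i , ≤-refl , cong (label ∘ proj₂ ∘ current) run≡ , _ , r , cong advance run≡
        finishes i (_ ◅ w) x r run≡ =
          let j , i<j , act≡ , starts = finishes (suc i) w x r (cong advance run≡)
          in  j , <⇒≤ i<j , act≡ , starts

        every-round-starts : ∀ m → ∃ λ i → m ≤ i × Starts m (run i)
        every-round-starts zero    = 0 , z≤n , e , ε , refl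
        every-round-starts (suc m) =
          let i , m≤i , _ , _ , run≡ = every-round-starts m
              j , i≤j , _ , starts   = finishes i _ _ _ run≡
          in  suc j , s≤s (≤-trans m≤i i≤j) , starts

        -- Perpetually B-reachable actions in B are served as well.
        fairPath-hyperfair : WeakHyperfair M B fairPath
        fairPath-hyperfair k _ a _ perp =
          let m , k≤m , m↦a           = mod-surjective-≥ nA a k
              i , m≤i , _ , r , run≡ = every-round-starts m
              k≤i                    = ≤-trans k≤m m≤i
              reachable              = subst₂ (ActBReachable M B) (sym m↦a) (cong here run≡) (perp i k≤i tt)
              j , i≤j , act≡ , _     = finishes i _ _ _ run≡
          in  j , ≤-trans k≤i i≤j , tt , ≡-trans act≡ (≡-trans (target-scheduled m r reachable) m↦a)

      hyperfair-from : ∀ e → ∃ λ (ρ : Path M) → state ρ 0 ≡ e × WeakHyperfair M B ρ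
      hyperfair-from e with any? (λ t → FiniteReachability.star? (Step? U?) e t ×-dec Stuck? t)
      ... | yes (_ , w , stuck) =
        walk⇒path w , refl , stuck⇒hyperfair (walk⇒path w) refl (subst Stuck (sym (walkState-end w)) stuck)
      ... | no never-stuck = fairPath , refl , fairPath-hyperfair
        where
        live : ∀ {t} → Star (Step U) e t → ∃ λ a → ActBReachable M B a t
        live {t} w with any? (λ a → ¬? (a ∈? B) ×-dec ActBReachable? a t)
        ... | yes (a , _ , reachable) = a , reachable
        ... | no  none                =
          ⊥-elim (never-stuck (t , w , λ a a∉B reachable → none (a , a∉B , reachable)))
        open FairRun e live

proposition37 : (M : LTS) (B : Subset (LTS.nA M)) (π : Path M) → Finite M π →
    Σ (Path M) λ π' → Extends M π' π × WeakHyperfair M B π'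
proposition37 M B π (n , len≡) with hyperfair-from M (act π 0) B (state π n)
... | ρ , ρ-start , ρ-fair = path , extends , hyperfair ρ-fair
  where open Append M π len≡ ρ (sym ρ-start)
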